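{- For every prime power $q$, the power graph $P(PSp(4,q))$ is not $\{P_{5}, \overline{P_{5}}\}$-free.
   Context: The power graph $P(G)$ of a group $G$ has vertex set $G$, with distinct $u,v$ adjacent if and only if $u=v^m$ or $v=u^n$ for some positive integers $m,n$. $P_5$ is the path on $5$ vertices and $\overline{P_5}$ its complement. A graph is $\{H_1,H_2\}$-free if it contains no induced subgraph isomorphic to $H_1$ and none isomorphic to $H_2$. -}

module Defs where

open import Level using (Level; _⊔_)
open import Algebra.Bundles using (CommutativeRing)
open import Data.Nat using (ℕ) renaming (zero to nzero; suc to nsuc)
open import Data.Fin using (Fin; zero; suc; toℕ)
open import Data.Product using (Σ; ∃; _×_; _,_)
open import Data.Sum using (_⊎_)
open import Relation.Nullary using (¬_; Dec)
open import Relation.Binary.PropositionalEquality using (_≡_)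
open import Function.Bundles using (_⇔_)

record FiniteField (c ℓ : Level) : Set (Level.suc (c ⊔ ℓ)) where
  field
    commRing   : CommutativeRing c ℓ
  open CommutativeRing commRing public
  field
    1≉0        : ¬ (1# ≈ 0#)
    inverse    : ∀ x → ¬ (x ≈ 0#) → Σ Carrier λ y → (x * y) ≈ 1#
    _≟F_       : ∀ x y → Dec (x ≈ y)
    size       : ℕ
    enum       : Fin size → Carrier
    enum-onto  : ∀ x → Σ (Fin size) λ i → enum i ≈ x

record Graph (v e r : Level) : Set (Level.suc (v ⊔ e ⊔ r)) where
  field
    Vertex : Set v
    _≃_    : Vertex → Vertex → Set e
    Adj    : Vertex → Vertex → Set r

P5Adj : Fin 5 → Fin 5 → Set
P5Adj i j = (nsuc (toℕ i) ≡ toℕ j) ⊎ (nsuc (toℕ j) ≡ toℕ i)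

coP5Adj : Fin 5 → Fin 5 → Set
coP5Adj i j = ¬ P5Adj i j

module _ {v e r} (G : Graph v e r) where
  open Graph G

  HasInduced5 : (Fin 5 → Fin 5 → Set) → Set (v ⊔ e ⊔ r)
  HasInduced5 H = Σ (Fin 5 → Vertex) λ f →
      (∀ i j → ¬ (i ≡ j) → ¬ (f i ≃ f j))
    × (∀ i j → ¬ (i ≡ j) → (Adj (f i) (f j) ⇔ H i j))

  P5coP5Free : Set (v ⊔ e ⊔ r)
  P5coP5Free = ¬ HasInduced5 P5Adj × ¬ HasInduced5 coP5Adj

module Symplectic {c ℓ} (F : FiniteField c ℓ) where
  open FiniteField F using (Carrier; _≈_; _+_; _*_; -_; 0#; 1#)

  Mat : Set c
  Mat = Fin 4 → Fin 4 → Carrier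

  _≈M_ : Mat → Mat → Set ℓ
  A ≈M B = ∀ i j → A i j ≈ B i j

  sum4 : (Fin 4 → Carrier) → Carrier
  sum4 f = f zero + (f (suc zero) + (f (suc (suc zero)) + f (suc (suc (suc zero)))))

  _·_ : Mat → Mat → Mat
  (A · B) i j = sum4 λ k → A i k * B k j

  transpose : Mat → Mat
  transpose A i j = A j i

  negM : Mat → Mat
  negM A i j = - A i j

  I4 : Mat
  I4 zero zero = 1#
  I4 (suc zero) (suc zero) = 1#
  I4 (suc (suc zero)) (suc (suc zero)) = 1#
  I4 (suc (suc (suc zero))) (suc (suc (suc zero))) = 1#
  I4 _ _ = 0#

  -- standard symplectic form J = [[0, I₂], [-I₂, 0]]
  J : Mat
  J zero (suc (suc zero)) = 1#
  J (suc zero) (suc (suc (suc zero))) = 1#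
  J (suc (suc zero)) zero = - 1#
  J (suc (suc (suc zero))) (suc zero) = - 1#
  J _ _ = 0#

  IsSymplectic : Mat → Set ℓ
  IsSymplectic A = (transpose A · (J · A)) ≈M J

  Sp4 : Set (c ⊔ ℓ)
  Sp4 = Σ Mat IsSymplectic

  -- positive powers: pow A k = A^(k+1)
  pow : Mat → ℕ → Mat
  pow A nzero = A
  pow A (nsuc k) = A · pow A k

  -- equality in PSp(4,F) = Sp(4,F)/{±I}
  _≈P_ : Sp4 → Sp4 → Set ℓ
  (A , _) ≈P (B , _) = A ≈M B ⊎ A ≈M negM B

  IsPowerOf : Sp4 → Sp4 → Set ℓ
  IsPowerOf (A , _) (B , _) = ∃ λ k → A ≈M pow B k ⊎ A ≈M negM (pow B k)

  PowerAdj : Sp4 → Sp4 → Set ℓ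
  PowerAdj u v = ¬ (u ≈P v) × (IsPowerOf u v ⊎ IsPowerOf v u)

  PowerGraphPSp4 : Graph (c ⊔ ℓ) ℓ ℓ
  PowerGraphPSp4 = record { Vertex = Sp4 ; _≃_ = _≈P_ ; Adj = PowerAdj }

-- Over ℤ take symplectic matrices x₁, x₂ of order 6 with x₁⁴ = x₂⁴ = t of order 3
-- but ⟨x₁⟩ ≠ ⟨x₂⟩.  Then x₁³ — x₁ — t — x₂ — x₂³ is an induced path in the power
-- graph: the adjacencies are the displayed powers, and a non-adjacency u ≁ v holds
-- because every power of v differs from u at an entry where one matrix has 0 and
-- the other ±1.  All entries involved lie in {0, ±1}, and such a difference
-- survives, even up to sign, in every nontrivial ring; so the integer computation
-- transfers verbatim to Sp(4, F) and PSp(4, F) for every field F.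
module Submission where

open import Defs
open import Relation.Nullary using (¬_; Dec; yes; no)
open import Relation.Nullary.Decidable using (toWitness; _×-dec_; _⊎-dec_; _→-dec_; ¬?)

open import Algebra.Bundles using (Ring)
open import Data.Nat using (ℕ; zero; suc) renaming (_+_ to _+ℕ_; _*_ to _*ℕ_)
import Data.Nat.Properties as ℕ
open import Data.Fin using (Fin; zero; suc; toℕ)
import Data.Fin.Properties as Fin
open import Data.Product using (Σ; ∃; _×_; _,_)
open import Data.Product.Properties using (≡-dec)
open import Data.Sum using (_⊎_; inj₁; inj₂)
import Data.Sum as Sum
open import Data.Empty using (⊥-elim)
open import Data.Vec using (Vec; lookup; _∷_; [])
open import Data.List using (List; map; upTo)
open import Data.List.Relation.Unary.Any as Any using (Any)
open import Data.List.Relation.Unary.All as All using (All)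
open import Relation.Binary.PropositionalEquality as ≡ using (_≡_; _≢_)
open import Function.Base using (_∘_)
open import Function.Bundles using (_⇔_; mk⇔)

-- The integer a − b, represented by the pair (a , b).
Diff : Set
Diff = ℕ × ℕ

0ᵈ 1ᵈ -1ᵈ : Diff
0ᵈ = 0 , 0
1ᵈ = 1 , 0
-1ᵈ = 0 , 1

_+ᵈ_ : Diff → Diff → Diff
(a , b) +ᵈ (c , d) = a +ℕ c , b +ℕ d

_*ᵈ_ : Diff → Diff → Diff
(a , b) *ᵈ (c , d) = a *ℕ c +ℕ b *ℕ d , a *ℕ d +ℕ b *ℕ c

normalize : Diff → Diff
normalize (suc a , suc b) = normalize (a , b)
normalize (a , b) = a , b

_≟ᵈ_ : (x y : Diff) → Dec (x ≡ y)
_≟ᵈ_ = ≡-dec ℕ._≟_ ℕ._≟_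

IsSign : Diff → Set
IsSign u = u ≡ 1ᵈ ⊎ u ≡ -1ᵈ

Apart : Diff → Diff → Set
Apart x y = (x ≡ 0ᵈ × IsSign y) ⊎ (IsSign x × y ≡ 0ᵈ)

apart? : ∀ x y → Dec (Apart x y)
apart? x y = (x ≟ᵈ 0ᵈ ×-dec sign? y) ⊎-dec (sign? x ×-dec y ≟ᵈ 0ᵈ)
  where
  sign? : ∀ u → Dec (IsSign u)
  sign? u = u ≟ᵈ 1ᵈ ⊎-dec u ≟ᵈ -1ᵈ

module DiffInterpretation {c ℓ} (R : Ring c ℓ) where
  open Ring R
  open import Algebra.Properties.Ring R using (-0#≈0#; -‿involutive; x[y-z]≈xy-xz; [y-z]x≈yx-zx)
  open import Algebra.Properties.AbelianGroup +-abelianGroup using (⁻¹-∙-comm; ⁻¹-anti-homo‿-)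
  open import Algebra.Properties.CommutativeSemigroup +-commutativeSemigroup using (interchange)
  open import Algebra.Properties.Semiring.Mult semiring using (×-homo-+; ×1-homo-*)
    renaming (_×_ to _⨰_)
  open import Relation.Binary.Reasoning.Setoid setoid

  ⟦_⟧ : Diff → Carrier
  ⟦ a , b ⟧ = a ⨰ 1# - b ⨰ 1#

  [x+y]-[u+v]≈[x-u]+[y-v] : ∀ x y u v → (x + y) - (u + v) ≈ (x - u) + (y - v)
  [x+y]-[u+v]≈[x-u]+[y-v] x y u v = begin
    (x + y) - (u + v)     ≈⟨ +-congˡ (⁻¹-∙-comm u v) ⟨
    (x + y) + (- u + - v) ≈⟨ interchange x y (- u) (- v) ⟩
    (x - u) + (y - v)     ∎

  ⟦+ᵈ⟧ : ∀ x y → ⟦ x +ᵈ y ⟧ ≈ ⟦ x ⟧ + ⟦ y ⟧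
  ⟦+ᵈ⟧ (a , b) (c , d) = begin
    (a +ℕ c) ⨰ 1# - (b +ℕ d) ⨰ 1#       ≈⟨ +-cong (×-homo-+ 1# a c) (-‿cong (×-homo-+ 1# b d)) ⟩
    (a ⨰ 1# + c ⨰ 1#) - (b ⨰ 1# + d ⨰ 1#) ≈⟨ [x+y]-[u+v]≈[x-u]+[y-v] _ _ _ _ ⟩
    (a ⨰ 1# - b ⨰ 1#) + (c ⨰ 1# - d ⨰ 1#) ∎

  ⟦*ᵈ⟧ : ∀ x y → ⟦ x *ᵈ y ⟧ ≈ ⟦ x ⟧ * ⟦ y ⟧
  ⟦*ᵈ⟧ (a , b) (c , d) = begin
    ⟦ (a , b) *ᵈ (c , d) ⟧            ≈⟨ +-cong (⟦ a ∙ c ⟧+⟦ b ∙ d ⟧) (-‿cong ⟦ a ∙ d ⟧+⟦ b ∙ c ⟧) ⟩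
    (A * C + B * D) - (A * D + B * C) ≈⟨ [x+y]-[u+v]≈[x-u]+[y-v] _ _ _ _ ⟩
    (A * C - A * D) + (B * D - B * C) ≈⟨ +-congˡ (⁻¹-anti-homo‿- (B * C) (B * D)) ⟨
    (A * C - A * D) - (B * C - B * D) ≈⟨ +-cong (x[y-z]≈xy-xz A C D) (-‿cong (x[y-z]≈xy-xz B C D)) ⟨
    A * (C - D) - B * (C - D)         ≈⟨ [y-z]x≈yx-zx (C - D) A B ⟨
    (A - B) * (C - D)                 ∎
    where
    A = a ⨰ 1#
    B = b ⨰ 1#
    C = c ⨰ 1#
    D = d ⨰ 1#
    ⟦_∙_⟧+⟦_∙_⟧ : ∀ m n p q → (m *ℕ n +ℕ p *ℕ q) ⨰ 1# ≈ (m ⨰ 1#) * (n ⨰ 1#) + (p ⨰ 1#) * (q ⨰ 1#)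
    ⟦ m ∙ n ⟧+⟦ p ∙ q ⟧ = trans (×-homo-+ 1# (m *ℕ n) (p *ℕ q)) (+-cong (×1-homo-* m n) (×1-homo-* p q))

  ⟦normalize⟧ : ∀ x → ⟦ normalize x ⟧ ≈ ⟦ x ⟧
  ⟦normalize⟧ (suc a , suc b) = begin
    ⟦ normalize (a , b) ⟧             ≈⟨ ⟦normalize⟧ (a , b) ⟩
    a ⨰ 1# - b ⨰ 1#                   ≈⟨ +-identityˡ _ ⟨
    0# + (a ⨰ 1# - b ⨰ 1#)            ≈⟨ +-congʳ (-‿inverseʳ 1#) ⟨
    (1# - 1#) + (a ⨰ 1# - b ⨰ 1#)     ≈⟨ [x+y]-[u+v]≈[x-u]+[y-v] _ _ _ _ ⟨
    ⟦ suc a , suc b ⟧                 ∎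
  ⟦normalize⟧ (zero , b) = refl
  ⟦normalize⟧ (suc a , zero) = refl

  ⟦0ᵈ⟧ : ⟦ 0ᵈ ⟧ ≈ 0#
  ⟦0ᵈ⟧ = trans (+-identityˡ _) -0#≈0#

  ⟦1ᵈ⟧ : ⟦ 1ᵈ ⟧ ≈ 1#
  ⟦1ᵈ⟧ = trans (+-cong (+-identityʳ 1#) -0#≈0#) (+-identityʳ 1#)

  ⟦-1ᵈ⟧ : ⟦ -1ᵈ ⟧ ≈ - 1#
  ⟦-1ᵈ⟧ = trans (+-identityˡ _) (-‿cong (+-identityʳ 1#))

  ≈±0⇒≈0 : ∀ {x y} → y ≈ 0# → x ≈ y ⊎ x ≈ - y → x ≈ 0#
  ≈±0⇒≈0 y≈0 (inj₁ x≈y)  = trans x≈y y≈0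
  ≈±0⇒≈0 y≈0 (inj₂ x≈-y) = trans x≈-y (trans (-‿cong y≈0) -0#≈0#)

  ≈±-sym : ∀ {x y} → x ≈ y ⊎ x ≈ - y → y ≈ x ⊎ y ≈ - x
  ≈±-sym (inj₁ x≈y)  = inj₁ (sym x≈y)
  ≈±-sym (inj₂ x≈-y) = inj₂ (trans (sym (-‿involutive _)) (-‿cong (sym x≈-y)))

  module _ (1≉0 : ¬ 1# ≈ 0#) where

    ⟦sign⟧≉0 : ∀ {u} → IsSign u → ¬ ⟦ u ⟧ ≈ 0#
    ⟦sign⟧≉0 (inj₁ ≡.refl) u≈0 = 1≉0 (trans (sym ⟦1ᵈ⟧) u≈0)
    ⟦sign⟧≉0 (inj₂ ≡.refl) u≈0 =
      1≉0 (trans (sym (-‿involutive 1#)) (trans (-‿cong (trans (sym ⟦-1ᵈ⟧) u≈0)) -0#≈0#))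

    apart⇒≉± : ∀ {x y} → Apart x y → ¬ (⟦ x ⟧ ≈ ⟦ y ⟧ ⊎ ⟦ x ⟧ ≈ - ⟦ y ⟧)
    apart⇒≉± (inj₁ (≡.refl , y±)) x≈±y = ⟦sign⟧≉0 y± (≈±0⇒≈0 ⟦0ᵈ⟧ (≈±-sym x≈±y))
    apart⇒≉± (inj₂ (x± , ≡.refl)) x≈±y = ⟦sign⟧≉0 x± (≈±0⇒≈0 ⟦0ᵈ⟧ x≈±y)

DMat : Set
DMat = Fin 4 → Fin 4 → Diff

mat : Vec (Vec Diff 4) 4 → DMat
mat rows i j = lookup (lookup rows i) j

sumᵈ : (Fin 4 → Diff) → Diff
sumᵈ f = f zero +ᵈ (f (suc zero) +ᵈ (f (suc (suc zero)) +ᵈ f (suc (suc (suc zero)))))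

_·ᵈ_ : DMat → DMat → DMat
(A ·ᵈ B) i j = normalize (sumᵈ λ k → A i k *ᵈ B k j)

powᵈ : DMat → ℕ → DMat
powᵈ B zero = B
powᵈ B (suc k) = B ·ᵈ powᵈ B k

transposeᵈ : DMat → DMat
transposeᵈ A i j = A j i

_≐_ : DMat → DMat → Set
A ≐ B = ∀ i j → A i j ≡ B i j

_≐?_ : ∀ A B → Dec (A ≐ B)
A ≐? B = Fin.all? λ i → Fin.all? λ j → A i j ≟ᵈ B i j

≐-trans : ∀ {A B C} → A ≐ B → B ≐ C → A ≐ C
≐-trans p q i j = ≡.trans (p i j) (q i j)

·ᵈ-congˡ : ∀ B {X Y} → X ≐ Y → (B ·ᵈ X) ≐ (B ·ᵈ Y)
·ᵈ-congˡ B X≐Y i j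
  rewrite X≐Y zero j | X≐Y (suc zero) j | X≐Y (suc (suc zero)) j | X≐Y (suc (suc (suc zero))) j
  = ≡.refl

_∈ᵈ_ : DMat → List DMat → Set
A ∈ᵈ S = Any (A ≐_) S

ClosedUnder : DMat → List DMat → Set
ClosedUnder B S = B ∈ᵈ S × All (λ s → (B ·ᵈ s) ∈ᵈ S) S

closedUnder? : ∀ B S → Dec (ClosedUnder B S)
closedUnder? B S = Any.any? (B ≐?_) S ×-dec All.all? (λ s → Any.any? ((B ·ᵈ s) ≐?_) S) S

powᵈ∈ : ∀ {B S} → ClosedUnder B S → ∀ k → powᵈ B k ∈ᵈ S
powᵈ∈ (B∈S , _) zero = B∈S
powᵈ∈ {B} cl@(_ , B·S⊆S) (suc k) =
  All.lookupWith (λ B·s∈S Bᵏ≐s → Any.map (≐-trans (·ᵈ-congˡ B Bᵏ≐s)) B·s∈S) B·S⊆S (powᵈ∈ cl k)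

powers : DMat → ℕ → List DMat
powers B n = map (powᵈ B) (upTo n)

PowerBelow : ℕ → DMat → DMat → Set
PowerBelow n A B = Σ (Fin n) λ k → powᵈ B (toℕ k) ≐ A

powerBelow? : ∀ n A B → Dec (PowerBelow n A B)
powerBelow? n A B = Fin.any? λ k → powᵈ B (toℕ k) ≐? A

Separated : DMat → DMat → Set
Separated A B = ∃ λ i → ∃ λ j → Apart (A i j) (B i j)

separated? : ∀ A B → Dec (Separated A B)
separated? A B = Fin.any? λ i → Fin.any? λ j → apart? (A i j) (B i j)

Jᵈ : DMat
Jᵈ = mat ((0ᵈ ∷ 0ᵈ ∷ 1ᵈ ∷ 0ᵈ ∷ []) ∷
          (0ᵈ ∷ 0ᵈ ∷ 0ᵈ ∷ 1ᵈ ∷ []) ∷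
          (-1ᵈ ∷ 0ᵈ ∷ 0ᵈ ∷ 0ᵈ ∷ []) ∷
          (0ᵈ ∷ -1ᵈ ∷ 0ᵈ ∷ 0ᵈ ∷ []) ∷ [])

module MatrixInterpretation {c ℓ} (F : FiniteField c ℓ) where
  open FiniteField F hiding (zero)
  open Symplectic F
  open DiffInterpretation ring public
  open import Relation.Binary.Reasoning.Setoid setoid

  ⟦_⟧M : DMat → Mat
  ⟦ A ⟧M i j = ⟦ A i j ⟧

  ≈M-refl : ∀ {A} → A ≈M A
  ≈M-refl i j = refl

  ≈M-sym : ∀ {A B} → A ≈M B → B ≈M A
  ≈M-sym A≈B i j = sym (A≈B i j)

  ≈M-trans : ∀ {A B C} → A ≈M B → B ≈M C → A ≈M C
  ≈M-trans A≈B B≈C i j = trans (A≈B i j) (B≈C i j)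

  negM-cong : ∀ {A B} → A ≈M B → negM A ≈M negM B
  negM-cong A≈B i j = -‿cong (A≈B i j)

  sum4-cong : ∀ {f g} → (∀ k → f k ≈ g k) → sum4 f ≈ sum4 g
  sum4-cong f≈g = +-cong (f≈g _) (+-cong (f≈g _) (+-cong (f≈g _) (f≈g _)))

  ·-cong : ∀ {A A′ B B′} → A ≈M A′ → B ≈M B′ → (A · B) ≈M (A′ · B′)
  ·-cong A≈ B≈ i j = sum4-cong λ k → *-cong (A≈ i k) (B≈ k j)

  ⟦≐⟧ : ∀ {A B} → A ≐ B → ⟦ A ⟧M ≈M ⟦ B ⟧M
  ⟦≐⟧ A≐B i j = reflexive (≡.cong ⟦_⟧ (A≐B i j))

  ⟦sumᵈ⟧ : ∀ f → ⟦ sumᵈ f ⟧ ≈ sum4 (λ k → ⟦ f k ⟧)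
  ⟦sumᵈ⟧ f = trans (⟦+ᵈ⟧ (f zero) _) (+-congˡ (trans (⟦+ᵈ⟧ (f (suc zero)) _)
                (+-congˡ (⟦+ᵈ⟧ (f (suc (suc zero))) (f (suc (suc (suc zero))))))))

  ⟦·ᵈ⟧ : ∀ A B → ⟦ A ·ᵈ B ⟧M ≈M (⟦ A ⟧M · ⟦ B ⟧M)
  ⟦·ᵈ⟧ A B i j = begin
    ⟦ normalize (sumᵈ p) ⟧ ≈⟨ ⟦normalize⟧ (sumᵈ p) ⟩
    ⟦ sumᵈ p ⟧             ≈⟨ ⟦sumᵈ⟧ p ⟩
    sum4 (λ k → ⟦ p k ⟧)   ≈⟨ sum4-cong {λ k → ⟦ p k ⟧} (λ k → ⟦*ᵈ⟧ (A i k) (B k j)) ⟩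
    (⟦ A ⟧M · ⟦ B ⟧M) i j  ∎
    where
    p : Fin 4 → Diff
    p k = A i k *ᵈ B k j

  ⟦powᵈ⟧ : ∀ B k → ⟦ powᵈ B k ⟧M ≈M pow ⟦ B ⟧M k
  ⟦powᵈ⟧ B zero = ≈M-refl
  ⟦powᵈ⟧ B (suc k) = ≈M-trans (⟦·ᵈ⟧ B (powᵈ B k)) (·-cong (≈M-refl {⟦ B ⟧M}) (⟦powᵈ⟧ B k))

  ⟦Jᵈ⟧ : ⟦ Jᵈ ⟧M ≈M J
  ⟦Jᵈ⟧ zero                   zero                   = ⟦0ᵈ⟧
  ⟦Jᵈ⟧ zero                   (suc zero)             = ⟦0ᵈ⟧
  ⟦Jᵈ⟧ zero                   (suc (suc zero))       = ⟦1ᵈ⟧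
  ⟦Jᵈ⟧ zero                   (suc (suc (suc zero))) = ⟦0ᵈ⟧
  ⟦Jᵈ⟧ (suc zero)             zero                   = ⟦0ᵈ⟧
  ⟦Jᵈ⟧ (suc zero)             (suc zero)             = ⟦0ᵈ⟧
  ⟦Jᵈ⟧ (suc zero)             (suc (suc zero))       = ⟦0ᵈ⟧
  ⟦Jᵈ⟧ (suc zero)             (suc (suc (suc zero))) = ⟦1ᵈ⟧
  ⟦Jᵈ⟧ (suc (suc zero))       zero                   = ⟦-1ᵈ⟧
  ⟦Jᵈ⟧ (suc (suc zero))       (suc zero)             = ⟦0ᵈ⟧
  ⟦Jᵈ⟧ (suc (suc zero))       (suc (suc zero))       = ⟦0ᵈ⟧
  ⟦Jᵈ⟧ (suc (suc zero))       (suc (suc (suc zero))) = ⟦0ᵈ⟧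
  ⟦Jᵈ⟧ (suc (suc (suc zero))) zero                   = ⟦0ᵈ⟧
  ⟦Jᵈ⟧ (suc (suc (suc zero))) (suc zero)             = ⟦-1ᵈ⟧
  ⟦Jᵈ⟧ (suc (suc (suc zero))) (suc (suc zero))       = ⟦0ᵈ⟧
  ⟦Jᵈ⟧ (suc (suc (suc zero))) (suc (suc (suc zero))) = ⟦0ᵈ⟧

  ⟦⟧-symplectic : ∀ A → (transposeᵈ A ·ᵈ (Jᵈ ·ᵈ A)) ≐ Jᵈ → IsSymplectic ⟦ A ⟧M
  ⟦⟧-symplectic A AᵀJA≐J = ≈M-trans (·-cong (≈M-refl {⟦ transposeᵈ A ⟧M}) JA≈)
    (≈M-trans (≈M-sym (⟦·ᵈ⟧ (transposeᵈ A) (Jᵈ ·ᵈ A))) (≈M-trans (⟦≐⟧ AᵀJA≐J) ⟦Jᵈ⟧))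
    where
    JA≈ : (J · ⟦ A ⟧M) ≈M ⟦ Jᵈ ·ᵈ A ⟧M
    JA≈ = ≈M-trans (·-cong (≈M-sym ⟦Jᵈ⟧) (≈M-refl {⟦ A ⟧M})) (≈M-sym (⟦·ᵈ⟧ Jᵈ A))

  _≈±_ : Mat → Mat → Set ℓ
  A ≈± B = A ≈M B ⊎ A ≈M negM B

  ≈±-respʳ : ∀ {A B C} → B ≈M C → A ≈± B → A ≈± C
  ≈±-respʳ B≈C = Sum.map (λ A≈B → ≈M-trans A≈B B≈C) (λ A≈-B → ≈M-trans A≈-B (negM-cong B≈C))

  separated⇒≉± : ∀ {A B} → Separated A B → ¬ (⟦ A ⟧M ≈± ⟦ B ⟧M)
  separated⇒≉± (i , j , apart) A≈±B = apart⇒≉± 1≉0 apart (Sum.map (λ e → e i j) (λ e → e i j) A≈±B)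

  not-power : ∀ {A B S} → ClosedUnder B S → All (Separated A) S →
              ∀ k → ¬ (⟦ A ⟧M ≈± pow ⟦ B ⟧M k)
  not-power {B = B} closed separated k A≈±Bᵏ with All.lookupAny separated (powᵈ∈ closed k)
  ... | A#s , Bᵏ≐s = separated⇒≉± A#s (≈±-respʳ (≈M-trans (≈M-sym (⟦powᵈ⟧ B k)) (⟦≐⟧ Bᵏ≐s)) A≈±Bᵏ)

  ⟦⟧-power : ∀ {n A B} → PowerBelow n A B → ∃ λ k → ⟦ A ⟧M ≈± pow ⟦ B ⟧M k
  ⟦⟧-power {B = B} (k , Bᵏ≐A) = toℕ k , inj₁ (≈M-trans (≈M-sym (⟦≐⟧ Bᵏ≐A)) (⟦powᵈ⟧ B (toℕ k)))

w₁ x₁ t x₂ w₂ : DMat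
w₁ = mat ((0ᵈ ∷ 1ᵈ ∷ 0ᵈ ∷ 0ᵈ ∷ []) ∷
          (1ᵈ ∷ 0ᵈ ∷ 0ᵈ ∷ 0ᵈ ∷ []) ∷
          (0ᵈ ∷ 0ᵈ ∷ 0ᵈ ∷ 1ᵈ ∷ []) ∷
          (0ᵈ ∷ 0ᵈ ∷ 1ᵈ ∷ 0ᵈ ∷ []) ∷ [])
x₁ = mat ((0ᵈ ∷ 0ᵈ ∷ 0ᵈ ∷ -1ᵈ ∷ []) ∷
          (0ᵈ ∷ 0ᵈ ∷ -1ᵈ ∷ 0ᵈ ∷ []) ∷
          (0ᵈ ∷ 1ᵈ ∷ 0ᵈ ∷ -1ᵈ ∷ []) ∷
          (1ᵈ ∷ 0ᵈ ∷ -1ᵈ ∷ 0ᵈ ∷ []) ∷ [])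
t  = mat ((0ᵈ ∷ 0ᵈ ∷ -1ᵈ ∷ 0ᵈ ∷ []) ∷
          (0ᵈ ∷ 0ᵈ ∷ 0ᵈ ∷ -1ᵈ ∷ []) ∷
          (1ᵈ ∷ 0ᵈ ∷ -1ᵈ ∷ 0ᵈ ∷ []) ∷
          (0ᵈ ∷ 1ᵈ ∷ 0ᵈ ∷ -1ᵈ ∷ []) ∷ [])
x₂ = mat ((0ᵈ ∷ 1ᵈ ∷ 0ᵈ ∷ 0ᵈ ∷ []) ∷
          (-1ᵈ ∷ 0ᵈ ∷ 1ᵈ ∷ 0ᵈ ∷ []) ∷
          (0ᵈ ∷ 0ᵈ ∷ 0ᵈ ∷ 1ᵈ ∷ []) ∷
          (-1ᵈ ∷ 0ᵈ ∷ 0ᵈ ∷ 0ᵈ ∷ []) ∷ [])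
w₂ = mat ((0ᵈ ∷ -1ᵈ ∷ 0ᵈ ∷ 1ᵈ ∷ []) ∷
          (0ᵈ ∷ 0ᵈ ∷ -1ᵈ ∷ 0ᵈ ∷ []) ∷
          (0ᵈ ∷ -1ᵈ ∷ 0ᵈ ∷ 0ᵈ ∷ []) ∷
          (1ᵈ ∷ 0ᵈ ∷ -1ᵈ ∷ 0ᵈ ∷ []) ∷ [])

path : Fin 5 → DMat
path zero                         = w₁
path (suc zero)                   = x₁
path (suc (suc zero))             = t
path (suc (suc (suc zero)))       = x₂
path (suc (suc (suc (suc zero)))) = w₂

order : Fin 5 → ℕ
order zero                         = 2
order (suc zero)                   = 6
order (suc (suc zero))             = 3
order (suc (suc (suc zero)))       = 6
order (suc (suc (suc (suc zero)))) = 2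

P5Adj? : ∀ i j → Dec (P5Adj i j)
P5Adj? i j = (suc (toℕ i) ℕ.≟ toℕ j) ⊎-dec (suc (toℕ j) ℕ.≟ toℕ i)

path-symplectic : ∀ i → (transposeᵈ (path i) ·ᵈ (Jᵈ ·ᵈ path i)) ≐ Jᵈ
path-symplectic = toWitness {a? = Fin.all? λ i → (transposeᵈ (path i) ·ᵈ (Jᵈ ·ᵈ path i)) ≐? Jᵈ} _

path-closed : ∀ i → ClosedUnder (path i) (powers (path i) (order i))
path-closed = toWitness {a? = Fin.all? λ i → closedUnder? (path i) (powers (path i) (order i))} _

path-separated : ∀ i j → i ≢ j → Separated (path i) (path j)
path-separated = toWitness {a? = Fin.all? λ i → Fin.all? λ j →
  ¬? (i Fin.≟ j) →-dec separated? (path i) (path j)} _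

path-edge : ∀ i j → P5Adj i j →
  PowerBelow (order j) (path i) (path j) ⊎ PowerBelow (order i) (path j) (path i)
path-edge = toWitness {a? = Fin.all? λ i → Fin.all? λ j →
  P5Adj? i j →-dec (powerBelow? (order j) (path i) (path j) ⊎-dec powerBelow? (order i) (path j) (path i))} _

path-non-edge : ∀ i j → i ≢ j → ¬ P5Adj i j → All (Separated (path i)) (powers (path j) (order j))
path-non-edge = toWitness {a? = Fin.all? λ i → Fin.all? λ j →
  ¬? (i Fin.≟ j) →-dec ¬? (P5Adj? i j) →-dec All.all? (separated? (path i)) (powers (path j) (order j))} _

module InducedPath {c ℓ} (F : FiniteField c ℓ) where
  open Symplectic F
  open MatrixInterpretation F

  vertex : Fin 5 → Sp4
  vertex i = ⟦ path i ⟧M , ⟦⟧-symplectic (path i) (path-symplectic i)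

  vertex-distinct : ∀ i j → i ≢ j → ¬ (vertex i ≈P vertex j)
  vertex-distinct i j i≢j = separated⇒≉± (path-separated i j i≢j)

  vertex-not-power : ∀ i j → i ≢ j → ¬ P5Adj i j → ¬ IsPowerOf (vertex i) (vertex j)
  vertex-not-power i j i≢j ¬adj (k , i≈±jᵏ) = not-power (path-closed j) (path-non-edge i j i≢j ¬adj) k i≈±jᵏ

  vertex-adj⇔ : ∀ i j → i ≢ j → PowerAdj (vertex i) (vertex j) ⇔ P5Adj i j
  vertex-adj⇔ i j i≢j with P5Adj? i j
  ... | yes adj = mk⇔ (λ _ → adj) (λ _ → vertex-distinct i j i≢j , Sum.map ⟦⟧-power ⟦⟧-power (path-edge i j adj))
  ... | no ¬adj = mk⇔ (λ (_ , power) → ⊥-elim (Sum.[ vertex-not-power i j i≢j ¬adj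
                                                  , vertex-not-power j i (i≢j ∘ ≡.sym) (¬adj ∘ Sum.swap) ] power))
                      (⊥-elim ∘ ¬adj)

mainTheorem19 : ∀ {c ℓ} (F : FiniteField c ℓ) →
    ¬ P5coP5Free (Symplectic.PowerGraphPSp4 F)
mainTheorem19 F (noInducedP5 , _) = noInducedP5 (vertex , vertex-distinct , vertex-adj⇔)
  where open InducedPath F
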